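{- Let $R$ be a finite commutative ring with identity, written as a direct sum of local rings $R = R_1\oplus\cdots\oplus R_n$, where $R_i$ has unique maximal ideal $M_i$ and $q_i=|R_i/M_i|$. Then $R$ is generated by its units (i.e. the smallest subring of $R$ containing all units of $R$ is $R$ itself) if and only if at most one of $q_1,\ldots,q_n$ equals $2$.
   Context: Every finite commutative ring with identity is uniquely a direct sum of finite local rings. -}

module Defs where

open import Level using (Level; _⊔_; suc)
open import Algebra.Bundles using (CommutativeRing)
open import Data.Nat using (ℕ)
open import Data.Fin using (Fin)
open import Data.Product using (Σ; ∃; _×_; _,_)
open import Data.Sum using (_⊎_)
open import Relation.Unary using (Pred; _⊆_)
open import Relation.Nullary using (¬_)
open import Relation.Binary.PropositionalEquality using (_≡_)

private variable c ℓ : Level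

module _ (R : CommutativeRing c ℓ) where
  open CommutativeRing R

  record Finite : Set (c ⊔ ℓ) where
    field
      size    : ℕ
      index   : Carrier → Fin size
      elem    : Fin size → Carrier
      index-cong : ∀ {x y} → x ≈ y → index x ≡ index y
      elem-index : ∀ x → elem (index x) ≈ x
      index-elem : ∀ i → index (elem i) ≡ i

  Subset : Set (suc (c ⊔ ℓ))
  Subset = Pred Carrier (c ⊔ ℓ)

  record IsIdeal (I : Subset) : Set (c ⊔ ℓ) where
    field
      resp  : ∀ {x y} → x ≈ y → I x → I y
      has-0 : I 0#
      +-closed : ∀ {x y} → I x → I y → I (x + y)
      neg-closed : ∀ {x} → I x → I (- x)
      *-closed : ∀ r {x} → I x → I (r * x)

  record IsMaximalIdeal (M : Subset) : Set (suc (c ⊔ ℓ)) where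
    field
      isIdeal : IsIdeal M
      proper  : ¬ M 1#
      maximal : ∀ (J : Subset) → IsIdeal J → M ⊆ J → (J ⊆ M) ⊎ (∀ x → J x)

  record IsUniqueMaximalIdeal (M : Subset) : Set (suc (c ⊔ ℓ)) where
    field
      isMaximal : IsMaximalIdeal M
      unique    : ∀ (N : Subset) → IsMaximalIdeal N → (N ⊆ M) × (M ⊆ N)

  -- |R / I| = q : there is a complete system of q pairwise
  -- incongruent representatives of the cosets of I.
  record QuotientHasSize (I : Subset) (q : ℕ) : Set (c ⊔ ℓ) where
    field
      rep        : Fin q → Carrier
      rep-distinct : ∀ i j → I (rep i - rep j) → i ≡ j
      rep-cover  : ∀ x → ∃ λ i → I (x - rep i)

  IsUnit : Carrier → Set (c ⊔ ℓ)
  IsUnit x = ∃ λ y → x * y ≈ 1#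

  record IsSubring (S : Subset) : Set (c ⊔ ℓ) where
    field
      resp  : ∀ {x y} → x ≈ y → S x → S y
      has-1 : S 1#
      +-closed : ∀ {x y} → S x → S y → S (x + y)
      neg-closed : ∀ {x} → S x → S (- x)
      *-closed : ∀ {x y} → S x → S y → S (x * y)

  -- R is generated by its units: the smallest subring containing all
  -- units is R itself, i.e. every subring containing all units is all of R.
  GeneratedByUnits : Set (suc (c ⊔ ℓ))
  GeneratedByUnits = ∀ (S : Subset) → IsSubring S → (∀ x → IsUnit x → S x) → ∀ x → S x

record IsDirectSumOf (R : CommutativeRing c ℓ) (n : ℕ)
                     (Rs : Fin n → CommutativeRing c ℓ) : Set (c ⊔ ℓ) where
  private module R = CommutativeRing R
  private module Rs i = CommutativeRing (Rs i)
  field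
    φ      : R.Carrier → (i : Fin n) → Rs.Carrier i
    φ-cong : ∀ {x y} → x R.≈ y → ∀ i → Rs._≈_ i (φ x i) (φ y i)
    φ-+    : ∀ x y i → Rs._≈_ i (φ (x R.+ y) i) (Rs._+_ i (φ x i) (φ y i))
    φ-*    : ∀ x y i → Rs._≈_ i (φ (x R.* y) i) (Rs._*_ i (φ x i) (φ y i))
    φ-1    : ∀ i → Rs._≈_ i (φ R.1# i) (Rs.1# i)
    φ-injective  : ∀ {x y} → (∀ i → Rs._≈_ i (φ x i) (φ y i)) → x R.≈ y
    φ-surjective : ∀ (g : (i : Fin n) → Rs.Carrier i) →
                   ∃ λ x → ∀ i → Rs._≈_ i (φ x i) (g i)

-- The definition of a
-- maximal ideal used here decides every proposition (excludedMiddle), and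
-- with that and an enumeration of the ring every proper ideal extends
-- greedily to a maximal one; uniqueness of Mᵢ then shows that the units of
-- Rᵢ are exactly the elements outside Mᵢ.  Working modulo Mᵢ with the
-- residue classes given by QuotientHasSize: if qᵢ ≠ 2 every element is a
-- sum of two units; elements of Mᵢ always are; and if qᵢ = 2 the map
-- x ↦ [x ∈ Mᵢ] is a ring morphism onto 𝔽₂ (the "parity" lemmas).
--
-- Componentwise sums of two units lift to R.  (⇐) If only qₖ can be 2,
-- every x, or x - 1, is a sum of two units.  (⇒) If qᵢ = qⱼ = 2, i ≠ j,
-- the elements whose i-th and j-th components have equal parity form a
-- subring containing all units but not the element 0 at i, 1 elsewhere.
module Submission where

open import Defs
open import Level using (Level; _⊔_; Lift; lift; lower)
open import Algebra.Bundles using (CommutativeRing)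
import Algebra.Properties.AbelianGroup as AbelianGroupProperties
import Algebra.Properties.CommutativeSemigroup as CommutativeSemigroupProperties
import Algebra.Properties.Ring as RingProperties
open import Data.Empty using (⊥-elim)
open import Data.Fin using (Fin; zero; suc; _≟_)
open import Data.List using (List; []; _∷_; allFin)
open import Data.List.Membership.Propositional using (_∈_)
open import Data.List.Membership.Propositional.Properties using (∈-allFin)
open import Data.List.Relation.Unary.Any using (here; there)
open import Data.Nat using (ℕ; zero; suc)
import Data.Nat as ℕ
import Data.Fin.Properties as FinProperties
open import Data.Product using (Σ-syntax; ∃; ∃₂; _×_; _,_; proj₁; proj₂)
open import Data.Sum using (_⊎_; inj₁; inj₂; [_,_]′)
open import Data.Sum.Function.Propositional using (_⊎-⇔_)
open import Function.Base using (_∘_)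
open import Function.Bundles using (_⇔_; mk⇔; Equivalence)
import Function.Properties.Equivalence as ⇔
open import Relation.Binary.PropositionalEquality as ≡ using (_≡_; _≢_)
open import Relation.Nullary using (¬_; yes; no)
open import Relation.Unary using (_⊆_)

open Equivalence using (to; from)

⇔-cong₂ : ∀ {a} {P P′ Q Q′ : Set a} → P ⇔ P′ → Q ⇔ Q′ → (P ⇔ Q) ⇔ (P′ ⇔ Q′)
⇔-cong₂ P⇔P′ Q⇔Q′ =
  mk⇔ (λ P⇔Q → ⇔.trans (⇔.sym P⇔P′) (⇔.trans P⇔Q Q⇔Q′))
      (λ P′⇔Q′ → ⇔.trans P⇔P′ (⇔.trans P′⇔Q′ (⇔.sym Q⇔Q′)))

exhaust₂ : ∀ {q} → q ≡ 2 → (a b x : Fin q) → a ≢ b → x ≡ a ⊎ x ≡ b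
exhaust₂ ≡.refl zero       zero       _          a≢b = ⊥-elim (a≢b ≡.refl)
exhaust₂ ≡.refl zero       (suc zero) zero       _   = inj₁ ≡.refl
exhaust₂ ≡.refl zero       (suc zero) (suc zero) _   = inj₂ ≡.refl
exhaust₂ ≡.refl (suc zero) zero       zero       _   = inj₂ ≡.refl
exhaust₂ ≡.refl (suc zero) zero       (suc zero) _   = inj₁ ≡.refl
exhaust₂ ≡.refl (suc zero) (suc zero) _          a≢b = ⊥-elim (a≢b ≡.refl)

avoid₃ : ∀ {m} (x y : Fin (3 ℕ.+ m)) → ∃ λ k → k ≢ x × k ≢ y
avoid₃ zero             zero          = suc zero , (λ ()) , (λ ())
avoid₃ zero             (suc zero)    = suc (suc zero) , (λ ()) , (λ ())
avoid₃ zero             (suc (suc _)) = suc zero , (λ ()) , (λ ())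
avoid₃ (suc zero)       zero          = suc (suc zero) , (λ ()) , (λ ())
avoid₃ (suc zero)       (suc _)       = zero , (λ ()) , (λ ())
avoid₃ (suc (suc _))    zero          = suc zero , (λ ()) , (λ ())
avoid₃ (suc (suc _))    (suc _)       = zero , (λ ()) , (λ ())

-- If Fin q has two distinct elements but q ≠ 2, then q ≥ 3.
avoid : ∀ {q} → q ≢ 2 → {a b : Fin q} → a ≢ b → (x y : Fin q) → ∃ λ k → k ≢ x × k ≢ y
avoid {zero} _ {()}
avoid {suc zero} _ {zero} {zero} a≢b = ⊥-elim (a≢b ≡.refl)
avoid {suc (suc zero)} q≢2 _ = ⊥-elim (q≢2 ≡.refl)
avoid {suc (suc (suc m))} _ _ = avoid₃

module AdditiveFacts {c ℓ} (A : CommutativeRing c ℓ) where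
  open CommutativeRing A
  open AbelianGroupProperties +-abelianGroup public
    using (⁻¹-involutive; ⁻¹-anti-homo‿-; ε⁻¹≈ε; xyx⁻¹≈y; ⁻¹-∙-comm; inverseʳ-unique)
  open CommutativeSemigroupProperties +-commutativeSemigroup public using (interchange)
  open import Relation.Binary.Reasoning.Setoid setoid

  x-0≈x : ∀ x → x - 0# ≈ x
  x-0≈x x = trans (+-congˡ ε⁻¹≈ε) (+-identityʳ x)

  [x-y]+[y-z]≈x-z : ∀ x y z → (x - y) + (y - z) ≈ x - z
  [x-y]+[y-z]≈x-z x y z = begin
    (x - y) + (y - z)     ≈⟨ +-assoc x (- y) (y - z) ⟩
    x + (- y + (y - z))   ≈⟨ +-congˡ (sym (+-assoc (- y) y (- z))) ⟩
    x + ((- y + y) - z)   ≈⟨ +-congˡ (+-congʳ (-‿inverseˡ y)) ⟩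
    x + (0# - z)          ≈⟨ +-congˡ (+-identityˡ (- z)) ⟩
    x - z                 ∎

  [y-r]+r≈y : ∀ y r → (y - r) + r ≈ y
  [y-r]+r≈y y r = begin
    (y - r) + r     ≈⟨ +-assoc y (- r) r ⟩
    y + (- r + r)   ≈⟨ +-congˡ (-‿inverseˡ r) ⟩
    y + 0#          ≈⟨ +-identityʳ y ⟩
    y               ∎

module IdealConstructions {c ℓ} (A : CommutativeRing c ℓ) where
  open CommutativeRing A
  open AdditiveFacts A using (ε⁻¹≈ε; ⁻¹-∙-comm; interchange)
  open RingProperties ring using (-‿distribˡ-*)

  ideal-with-1 : ∀ {I} → IsIdeal A I → I 1# → ∀ x → I x
  ideal-with-1 I-ideal I1 x = resp (*-identityʳ x) (*-closed x I1)
    where open IsIdeal I-ideal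

  zeroIdeal : Subset A
  zeroIdeal x = Lift c (x ≈ 0#)

  zeroIdeal-isIdeal : IsIdeal A zeroIdeal
  zeroIdeal-isIdeal = record
    { resp       = λ x≈y x≈0 → lift (trans (sym x≈y) (lower x≈0))
    ; has-0      = lift refl
    ; +-closed   = λ x≈0 y≈0 → lift (trans (+-cong (lower x≈0) (lower y≈0)) (+-identityʳ 0#))
    ; neg-closed = λ x≈0 → lift (trans (-‿cong (lower x≈0)) ε⁻¹≈ε)
    ; *-closed   = λ r x≈0 → lift (trans (*-congˡ (lower x≈0)) (zeroʳ r))
    }

  _+⟨_⟩ : Subset A → Carrier → Subset A
  (I +⟨ x ⟩) z = ∃₂ λ i r → I i × z ≈ i + r * x

  +⟨⟩-isIdeal : ∀ {I} x → IsIdeal A I → IsIdeal A (I +⟨ x ⟩)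
  +⟨⟩-isIdeal {I} x I-ideal = record
    { resp       = λ { z≈w (i , r , Ii , z≈) → i , r , Ii , trans (sym z≈w) z≈ }
    ; has-0      = 0# , 0# , has-0 , sym (trans (+-identityˡ (0# * x)) (zeroˡ x))
    ; +-closed   = λ { (i , r , Ii , z≈) (j , s , Ij , w≈) →
        i + j , r + s , +-closed Ii Ij ,
        trans (+-cong z≈ w≈) (trans (interchange i (r * x) j (s * x)) (+-congˡ (sym (distribʳ x r s)))) }
    ; neg-closed = λ { (i , r , Ii , z≈) →
        - i , - r , neg-closed Ii ,
        trans (-‿cong z≈) (trans (sym (⁻¹-∙-comm i (r * x))) (+-congˡ (-‿distribˡ-* r x))) }
    ; *-closed   = λ { t (i , r , Ii , z≈) →
        t * i , t * r , *-closed t Ii ,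
        trans (*-congˡ z≈) (trans (distribˡ t i (r * x)) (+-congˡ (sym (*-assoc t r x)))) }
    }
    where open IsIdeal I-ideal

  ⊆-+⟨⟩ : ∀ {I x} → IsIdeal A I → I ⊆ I +⟨ x ⟩
  ⊆-+⟨⟩ {x = x} _ {z} Iz = z , 0# , Iz , sym (trans (+-congˡ (zeroˡ x)) (+-identityʳ z))

  x∈+⟨x⟩ : ∀ {I x} → IsIdeal A I → (I +⟨ x ⟩) x
  x∈+⟨x⟩ {x = x} I-ideal = 0# , 1# , IsIdeal.has-0 I-ideal , sym (trans (+-identityˡ (1# * x)) (*-identityˡ x))

  +⟨⟩-mono : ∀ {I J x} → I ⊆ J → I +⟨ x ⟩ ⊆ J +⟨ x ⟩
  +⟨⟩-mono I⊆J (i , r , Ii , z≈) = i , r , I⊆J Ii , z≈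

  +⟨⟩-least : ∀ {I J x} → IsIdeal A J → I ⊆ J → J x → I +⟨ x ⟩ ⊆ J
  +⟨⟩-least J-ideal I⊆J Jx (i , r , Ii , z≈) = resp (sym z≈) (+-closed (I⊆J Ii) (*-closed r Jx))
    where open IsIdeal J-ideal

  ∪-proposition-isIdeal : ∀ {I} → IsIdeal A I → (Q : Set (c ⊔ ℓ)) → IsIdeal A (λ x → I x ⊎ Q)
  ∪-proposition-isIdeal I-ideal Q = record
    { resp       = λ { e (inj₁ Ix) → inj₁ (resp e Ix) ; _ (inj₂ q) → inj₂ q }
    ; has-0      = inj₁ has-0
    ; +-closed   = λ { (inj₁ Ix) (inj₁ Iy) → inj₁ (+-closed Ix Iy)
                     ; (inj₂ q) _ → inj₂ q ; _ (inj₂ q) → inj₂ q }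
    ; neg-closed = λ { (inj₁ Ix) → inj₁ (neg-closed Ix) ; (inj₂ q) → inj₂ q }
    ; *-closed   = λ { r (inj₁ Ix) → inj₁ (*-closed r Ix) ; _ (inj₂ q) → inj₂ q }
    }
    where open IsIdeal I-ideal

-- The notion of maximal ideal in use is strong: applying maximality to
-- M ∪ {everything, if Q} decides Q.
excludedMiddle : ∀ {c ℓ} (A : CommutativeRing c ℓ) {M : Subset A} →
                 IsMaximalIdeal A M → (Q : Set (c ⊔ ℓ)) → Q ⊎ ¬ Q
excludedMiddle A {M} M-maximal Q
  with maximal (λ x → M x ⊎ Q) (∪-proposition-isIdeal isIdeal Q) inj₁
  where open IsMaximalIdeal M-maximal
        open IdealConstructions A
... | inj₁ M∪Q⊆M = inj₂ (λ q → IsMaximalIdeal.proper M-maximal (M∪Q⊆M (inj₂ q)))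
... | inj₂ everything with everything (CommutativeRing.1# A)
...   | inj₁ M1 = ⊥-elim (IsMaximalIdeal.proper M-maximal M1)
...   | inj₂ q  = inj₁ q

record Enumeration {c ℓ} (A : CommutativeRing c ℓ) : Set (c ⊔ ℓ) where
  open CommutativeRing A
  field
    size  : ℕ
    elem  : Fin size → Carrier
    cover : ∀ x → ∃ λ k → elem k ≈ x

-- In an enumerated ring with excluded middle, every proper ideal lies in a
-- maximal ideal: run through the elements, adjoining each one unless that
-- would make the ideal improper.
module MaximalIdealExistence {c ℓ} (A : CommutativeRing c ℓ)
         (em : (Q : Set (c ⊔ ℓ)) → Q ⊎ ¬ Q) (E : Enumeration A) where
  open CommutativeRing A
  open Enumeration E
  open IdealConstructions A

  record IsProperIdeal (N : Subset A) : Set (c ⊔ ℓ) where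
    field
      isIdeal : IsIdeal A N
      proper  : ¬ N 1#

  Settled : Subset A → Carrier → Set (c ⊔ ℓ)
  Settled N x = N x ⊎ (N +⟨ x ⟩) 1#

  Settled-mono : ∀ {N N′ x} → N ⊆ N′ → Settled N x → Settled N′ x
  Settled-mono N⊆N′ (inj₁ Nx)   = inj₁ (N⊆N′ Nx)
  Settled-mono N⊆N′ (inj₂ 1∈N+x) = inj₂ (+⟨⟩-mono N⊆N′ 1∈N+x)

  extend : Subset A → Carrier → Subset A
  extend N x with em ((N +⟨ x ⟩) 1#)
  ... | inj₁ _ = N
  ... | inj₂ _ = N +⟨ x ⟩

  extend-step : ∀ {N} x → IsProperIdeal N →
                IsProperIdeal (extend N x) × N ⊆ extend N x × Settled (extend N x) x
  extend-step {N} x N-proper with em ((N +⟨ x ⟩) 1#)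
  ... | inj₁ 1∈N+x = N-proper , (λ Nz → Nz) , inj₂ 1∈N+x
  ... | inj₂ 1∉N+x =
    record { isIdeal = +⟨⟩-isIdeal x isIdeal ; proper = 1∉N+x } , ⊆-+⟨⟩ isIdeal , inj₁ (x∈+⟨x⟩ isIdeal)
    where open IsProperIdeal N-proper

  extendAll : List (Fin size) → Subset A → Subset A
  extendAll []       N = N
  extendAll (k ∷ ks) N = extendAll ks (extend N (elem k))

  extendAll-spec : ∀ ks {N} → IsProperIdeal N →
                   IsProperIdeal (extendAll ks N) × N ⊆ extendAll ks N ×
                   (∀ {k} → k ∈ ks → Settled (extendAll ks N) (elem k))
  extendAll-spec []       N-proper = N-proper , (λ Nz → Nz) , λ ()
  extendAll-spec (k ∷ ks) N-proper with extend-step (elem k) N-proper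
  ... | N′-proper , N⊆N′ , k-settled with extendAll-spec ks N′-proper
  ...   | N″-proper , N′⊆N″ , ks-settled =
    N″-proper , (λ Nz → N′⊆N″ (N⊆N′ Nz)) ,
    λ { (here ≡.refl) → Settled-mono N′⊆N″ k-settled ; (there k∈ks) → ks-settled k∈ks }

  settled⇒maximal : ∀ {N} → IsProperIdeal N → (∀ k → Settled N (elem k)) → IsMaximalIdeal A N
  settled⇒maximal {N} N-proper settled = record
    { isIdeal = isIdeal ; proper = proper ; maximal = maximality }
    where
    open IsProperIdeal N-proper
    maximality : ∀ J → IsIdeal A J → N ⊆ J → J ⊆ N ⊎ (∀ x → J x)
    maximality J J-ideal N⊆J with em (∃ λ x → J x × ¬ N x)
    ... | inj₂ nothing-outside =
      inj₁ λ {z} Jz → [ (λ Nz → Nz) , (λ z∉N → ⊥-elim (nothing-outside (z , Jz , z∉N))) ]′ (em (N z))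
    ... | inj₁ (x , Jx , x∉N) with cover x
    ...   | k , k≈x with settled k
    ...     | inj₁ Nk      = ⊥-elim (x∉N (IsIdeal.resp isIdeal k≈x Nk))
    ...     | inj₂ 1∈N+k   = inj₂ (ideal-with-1 J-ideal (+⟨⟩-least J-ideal N⊆J Jk 1∈N+k))
      where Jk = IsIdeal.resp J-ideal (sym k≈x) Jx

  maximalAbove : ∀ {I} → IsProperIdeal I → Σ[ N ∈ Subset A ] IsMaximalIdeal A N × I ⊆ N
  maximalAbove {I} I-proper with extendAll-spec (allFin size) I-proper
  ... | N-proper , I⊆N , settled =
    extendAll (allFin size) I , settled⇒maximal N-proper (λ k → settled (∈-allFin k)) , I⊆N

module Congruence {c ℓ} (A : CommutativeRing c ℓ) {I : Subset A} (I-ideal : IsIdeal A I) where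
  open CommutativeRing A
  open IsIdeal I-ideal
  open AdditiveFacts A

  infix 4 _∼_
  _∼_ : Carrier → Carrier → Set (c ⊔ ℓ)
  x ∼ y = I (x - y)

  ∼-sym : ∀ {x y} → x ∼ y → y ∼ x
  ∼-sym {x} {y} x∼y = resp (⁻¹-anti-homo‿- x y) (neg-closed x∼y)

  ∼-trans : ∀ {x y z} → x ∼ y → y ∼ z → x ∼ z
  ∼-trans {x} {y} {z} x∼y y∼z = resp ([x-y]+[y-z]≈x-z x y z) (+-closed x∼y y∼z)

  ∈⇒∼0 : ∀ {x} → I x → x ∼ 0#
  ∈⇒∼0 {x} Ix = resp (sym (x-0≈x x)) Ix

  ∼0⇒∈ : ∀ {x} → x ∼ 0# → I x
  ∼0⇒∈ {x} x∼0 = resp (x-0≈x x) x∼0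

  ∈-neg : ∀ {x} → I (- x) → I x
  ∈-neg {x} I-x = resp (⁻¹-involutive x) (neg-closed I-x)

  ∈-cancel : ∀ {a b} → I a → I (a + b) → I b
  ∈-cancel {a} {b} Ia Iab = resp (xyx⁻¹≈y a b) (+-closed Iab (neg-closed Ia))

module ResidueClasses {c ℓ} (A : CommutativeRing c ℓ) {I : Subset A} (I-ideal : IsIdeal A I)
         (I-proper : ¬ I (CommutativeRing.1# A)) {q : ℕ} (Q : QuotientHasSize A I q) where
  open CommutativeRing A
  open Congruence A I-ideal
  open QuotientHasSize Q

  cls : Carrier → Fin q
  cls x = proj₁ (rep-cover x)

  ∼-rep : ∀ x → x ∼ rep (cls x)
  ∼-rep x = proj₂ (rep-cover x)

  cls-injective : ∀ {x y} → cls x ≡ cls y → x ∼ y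
  cls-injective {x} {y} e = ∼-trans (∼-rep x) (≡.subst (λ k → rep k ∼ y) (≡.sym e) (∼-sym (∼-rep y)))

  cls-cong : ∀ {x y} → x ∼ y → cls x ≡ cls y
  cls-cong {x} {y} x∼y = rep-distinct (cls x) (cls y) (∼-trans (∼-sym (∼-rep x)) (∼-trans x∼y (∼-rep y)))

  cls-rep : ∀ k → cls (rep k) ≡ k
  cls-rep k = rep-distinct (cls (rep k)) k (∼-sym (∼-rep (rep k)))

  cls0≢cls1 : cls 0# ≢ cls 1#
  cls0≢cls1 e = I-proper (∼0⇒∈ (∼-sym (cls-injective e)))

  two-classes : q ≡ 2 → ∀ x → I x ⊎ x ∼ 1#
  two-classes q≡2 x with exhaust₂ q≡2 (cls 0#) (cls 1#) (cls x) cls0≢cls1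
  ... | inj₁ x≡0 = inj₁ (∼0⇒∈ (cls-injective x≡0))
  ... | inj₂ x≡1 = inj₂ (cls-injective x≡1)

  third-class : q ≢ 2 → ∀ y → ∃ λ r → ¬ I r × ¬ I (y - r)
  third-class q≢2 y with avoid q≢2 cls0≢cls1 (cls 0#) (cls y)
  ... | k , k≢cls0 , k≢clsy =
    rep k ,
    (λ Ir → k≢cls0 (≡.trans (≡.sym (cls-rep k)) (cls-cong (∈⇒∼0 Ir)))) ,
    (λ y∼r → k≢clsy (≡.trans (≡.sym (cls-rep k)) (≡.sym (cls-cong y∼r))))

SumOfTwoUnits : ∀ {c ℓ} (A : CommutativeRing c ℓ) → CommutativeRing.Carrier A → Set (c ⊔ ℓ)
SumOfTwoUnits A z = ∃₂ λ u v → IsUnit A u × IsUnit A v × z ≈ u + v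
  where open CommutativeRing A

module LocalRing {c ℓ} (A : CommutativeRing c ℓ) {M : Subset A} (U : IsUniqueMaximalIdeal A M) where
  open CommutativeRing A
  open IsUniqueMaximalIdeal U
  open IsMaximalIdeal isMaximal public using (isIdeal; proper)
  module M = IsIdeal isIdeal
  open Congruence A isIdeal
  open IdealConstructions A
  open AdditiveFacts A using (⁻¹-involutive; [y-r]+r≈y)

  em : (Q : Set (c ⊔ ℓ)) → Q ⊎ ¬ Q
  em = excludedMiddle A isMaximal

  M-resp : ∀ {x y} → x ≈ y → M x ⇔ M y
  M-resp x≈y = mk⇔ (M.resp x≈y) (M.resp (sym x≈y))

  neg-parity : ∀ {x} → M (- x) ⇔ M x
  neg-parity = mk⇔ ∈-neg M.neg-closed

  unit∉M : ∀ {u} → IsUnit A u → ¬ M u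
  unit∉M {u} (v , uv≈1) Mu = proper (M.resp uv≈1 (M.resp (*-comm v u) (M.*-closed v Mu)))

  ∈M⇒[x-1]∉M : ∀ {x} → M x → ¬ M (x - 1#)
  ∈M⇒[x-1]∉M Mx x∼1 = proper (∼0⇒∈ (∼-trans (∼-sym x∼1) (∈⇒∼0 Mx)))

  module _ (E : Enumeration A) where
    open MaximalIdealExistence A em E

    -- Elements outside M are units: a non-unit a generates a proper
    -- ideal, which lies in a maximal ideal, which is M.
    ∉M⇒unit : ∀ {a} → ¬ M a → IsUnit A a
    ∉M⇒unit {a} a∉M with em (IsUnit A a)
    ... | inj₁ a-unit    = a-unit
    ... | inj₂ a-nonunit with maximalAbove Aa-proper
      where
      Aa-proper : IsProperIdeal (zeroIdeal +⟨ a ⟩)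
      Aa-proper = record
        { isIdeal = +⟨⟩-isIdeal a zeroIdeal-isIdeal
        ; proper  = λ { (i , r , lift i≈0 , 1≈) → a-nonunit (r ,
            trans (*-comm a r) (trans (sym (+-identityˡ (r * a))) (trans (+-congʳ (sym i≈0)) (sym 1≈)))) }
        }
    ...   | N , N-maximal , Aa⊆N =
      ⊥-elim (a∉M (proj₁ (unique N N-maximal) (Aa⊆N (x∈+⟨x⟩ zeroIdeal-isIdeal))))

    -- M is prime: an element outside M is invertible.
    M-prime : ∀ {x y} → M (x * y) → M x ⊎ M y
    M-prime {x} {y} Mxy with em (M x)
    ... | inj₁ Mx  = inj₁ Mx
    ... | inj₂ x∉M with ∉M⇒unit x∉M
    ...   | w , xw≈1 = inj₂ (M.resp w[xy]≈y (M.*-closed w Mxy))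
      where
      open import Relation.Binary.Reasoning.Setoid setoid
      w[xy]≈y : w * (x * y) ≈ y
      w[xy]≈y = begin
        w * (x * y)   ≈⟨ sym (*-assoc w x y) ⟩
        (w * x) * y   ≈⟨ *-congʳ (*-comm w x) ⟩
        (x * w) * y   ≈⟨ *-congʳ xw≈1 ⟩
        1# * y        ≈⟨ *-identityˡ y ⟩
        y             ∎

    -- x ↦ [x ∈ M] is multiplicative in 𝔽₂.
    *-parity : ∀ {x y} → M (x * y) ⇔ (M x ⊎ M y)
    *-parity {x} {y} = mk⇔ M-prime
      λ { (inj₁ Mx) → M.resp (*-comm y x) (M.*-closed y Mx) ; (inj₂ My) → M.*-closed x My }

    -- y = (y - 1) + 1 writes an element of M as a sum of two units.
    ∈M⇒sumOfTwoUnits : ∀ {y} → M y → SumOfTwoUnits A y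
    ∈M⇒sumOfTwoUnits {y} My =
      y - 1# , 1# , ∉M⇒unit (∈M⇒[x-1]∉M My) , (1# , *-identityˡ 1#) , sym ([y-r]+r≈y y 1#)

    -- With residue field size q ≠ 2, y = (y - r) + r for a class r ≠ 0, y.
    q≢2⇒sumOfTwoUnits : ∀ {q} → QuotientHasSize A M q → q ≢ 2 → ∀ y → SumOfTwoUnits A y
    q≢2⇒sumOfTwoUnits Q q≢2 y = split (third-class q≢2 y)
      where
      open ResidueClasses A isIdeal proper Q using (third-class)
      split : (∃ λ r → ¬ M r × ¬ M (y - r)) → SumOfTwoUnits A y
      split (r , r∉M , y-r∉M) = y - r , r , ∉M⇒unit y-r∉M , ∉M⇒unit r∉M , sym ([y-r]+r≈y y r)

  module _ {q} (Q : QuotientHasSize A M q) (q≡2 : q ≡ 2) where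
    open ResidueClasses A isIdeal proper Q using (two-classes)

    ∉M⇒∼1 : ∀ {x} → ¬ M x → x ∼ 1#
    ∉M⇒∼1 {x} x∉M with two-classes q≡2 x
    ... | inj₁ Mx  = ⊥-elim (x∉M Mx)
    ... | inj₂ x∼1 = x∼1

    -- With two residue classes, x ↦ [x ∈ M] is additive in 𝔽₂.
    +-parity : ∀ {x y} → M (x + y) ⇔ (M x ⇔ M y)
    +-parity {x} {y} = mk⇔ forward backward
      where
      forward : M (x + y) → M x ⇔ M y
      forward Mxy = mk⇔ (λ Mx → ∈-cancel Mx Mxy) (λ My → ∈-cancel My (M.resp (+-comm x y) Mxy))
      -- if x, y ∉ M then x ∼ 1 ∼ - y, so x + y = x - (- y) ∈ M
      backward : M x ⇔ M y → M (x + y)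
      backward Mx⇔My with em (M x)
      ... | inj₁ Mx  = M.+-closed Mx (to Mx⇔My Mx)
      ... | inj₂ x∉M = M.resp (+-congˡ (⁻¹-involutive y))
                         (∼-trans (∉M⇒∼1 x∉M) (∼-sym (∉M⇒∼1 (x∉M ∘ from Mx⇔My ∘ to neg-parity))))

module DirectSum {c ℓ} {R : CommutativeRing c ℓ} {n : ℕ} {Rs : Fin n → CommutativeRing c ℓ}
                 (D : IsDirectSumOf R n Rs) where
  module R = CommutativeRing R
  module Rs i = CommutativeRing (Rs i)
  open IsDirectSumOf D public

  φ-0 : ∀ i → Rs._≈_ i (φ R.0# i) (Rs.0# i)
  φ-0 i = RingProperties.x+x≈x⇒x≈0 (Rs.ring i) (φ R.0# i)
            (Rs.trans i (Rs.sym i (φ-+ R.0# R.0# i)) (φ-cong (R.+-identityʳ R.0#) i))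

  φ-neg : ∀ x i → Rs._≈_ i (φ (R.- x) i) (Rs.-_ i (φ x i))
  φ-neg x i = AdditiveFacts.inverseʳ-unique (Rs i) (φ x i) (φ (R.- x) i)
                (Rs.trans i (Rs.sym i (φ-+ x (R.- x) i)) (Rs.trans i (φ-cong (R.-‿inverseʳ x) i) (φ-0 i)))

  φ-unit : ∀ {u} → IsUnit R u → ∀ i → IsUnit (Rs i) (φ u i)
  φ-unit {u} (w , uw≈1) i = φ w i , Rs.trans i (Rs.sym i (φ-* u w i)) (Rs.trans i (φ-cong uw≈1 i) (φ-1 i))

  unit-lift : (g : ∀ i → Rs.Carrier i) → (∀ i → IsUnit (Rs i) (g i)) →
              ∃ λ u → (∀ i → Rs._≈_ i (φ u i) (g i)) × IsUnit R u
  unit-lift g g-units with φ-surjective g | φ-surjective (λ i → proj₁ (g-units i))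
  ... | u , φu≈g | w , φw≈g⁻¹ = u , φu≈g , w , φ-injective λ i →
    Rs.trans i (φ-* u w i) (Rs.trans i (Rs.*-cong i (φu≈g i) (φw≈g⁻¹ i))
      (Rs.trans i (proj₂ (g-units i)) (Rs.sym i (φ-1 i))))

  sumOfTwoUnits-lift : ∀ {y} → (∀ i → SumOfTwoUnits (Rs i) (φ y i)) → SumOfTwoUnits R y
  sumOfTwoUnits-lift {y} split
    with unit-lift (λ i → proj₁ (split i)) (λ i → proj₁ (proj₂ (proj₂ (split i))))
       | unit-lift (λ i → proj₁ (proj₂ (split i))) (λ i → proj₁ (proj₂ (proj₂ (proj₂ (split i)))))
  ... | u , φu , u-unit | v , φv , v-unit = u , v , u-unit , v-unit , φ-injective λ i →
    Rs.trans i (proj₂ (proj₂ (proj₂ (proj₂ (split i)))))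
      (Rs.trans i (Rs.+-cong i (Rs.sym i (φu i)) (Rs.sym i (φv i))) (Rs.sym i (φ-+ u v i)))

  _[_≔_] : (∀ a → Rs.Carrier a) → (i : Fin n) → Rs.Carrier i → ∀ a → Rs.Carrier a
  (g [ i ≔ y ]) a with a ≟ i
  ... | yes ≡.refl = y
  ... | no _       = g a

  update-at : ∀ g i y → (g [ i ≔ y ]) i ≡ y
  update-at g i y with i ≟ i
  ... | yes ≡.refl = ≡.refl
  ... | no i≢i     = ⊥-elim (i≢i ≡.refl)

  update-off : ∀ g i y {a} → a ≢ i → (g [ i ≔ y ]) a ≡ g a
  update-off g i y {a} a≢i with a ≟ i
  ... | yes a≡i = ⊥-elim (a≢i a≡i)
  ... | no _    = ≡.refl

  component-surjective : ∀ i y → ∃ λ x → Rs._≈_ i (φ x i) y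
  component-surjective i y with φ-surjective (Rs.0# [ i ≔ y ])
  ... | x , φx≈ = x , Rs.trans i (φx≈ i) (Rs.reflexive i (update-at Rs.0# i y))

  component-enumeration : Finite R → ∀ i → Enumeration (Rs i)
  component-enumeration R-finite i = record
    { size  = size
    ; elem  = λ k → φ (elem k) i
    ; cover = λ y → let (x , φx≈y) = component-surjective i y in
                    index x , Rs.trans i (φ-cong (elem-index x) i) φx≈y
    }
    where open Finite R-finite

module Classification {c ℓ} (R : CommutativeRing c ℓ) (R-finite : Finite R)
    (n : ℕ) (Rs : Fin n → CommutativeRing c ℓ) (D : IsDirectSumOf R n Rs)
    (M : (i : Fin n) → Subset (Rs i)) (U : ∀ i → IsUniqueMaximalIdeal (Rs i) (M i))
    (q : Fin n → ℕ) (Q : ∀ i → QuotientHasSize (Rs i) (M i) (q i)) where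

  open DirectSum D
  module L i = LocalRing (Rs i) (U i)

  E : ∀ i → Enumeration (Rs i)
  E = component-enumeration R-finite

  AtMostOneTwo : Set
  AtMostOneTwo = ∀ i j → q i ≡ 2 → q j ≡ 2 → i ≡ j

  module _ (S : Subset R) (S-subring : IsSubring R S) (units⊆S : ∀ x → IsUnit R x → S x) where
    open IsSubring S-subring

    componentwise-sumOfTwoUnits⇒∈S : ∀ {y} → (∀ i → SumOfTwoUnits (Rs i) (φ y i)) → S y
    componentwise-sumOfTwoUnits⇒∈S split with sumOfTwoUnits-lift split
    ... | u , v , u-unit , v-unit , y≈u+v = resp (R.sym y≈u+v) (+-closed (units⊆S u u-unit) (units⊆S v v-unit))

    no-two⇒∈S : (∀ i → q i ≢ 2) → ∀ x → S x
    no-two⇒∈S q≢2 x = componentwise-sumOfTwoUnits⇒∈S λ i → L.q≢2⇒sumOfTwoUnits i (E i) (Q i) (q≢2 i) (φ x i)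

    module _ (at-most-one : AtMostOneTwo) (k : Fin n) (qk≡2 : q k ≡ 2) where

      -- Only the k-th component can fail to be a sum of two units, and it
      -- does not fail when it lies in M k.
      Mk⇒∈S : ∀ {y} → M k (φ y k) → S y
      Mk⇒∈S {y} My = componentwise-sumOfTwoUnits⇒∈S split
        where
        split : ∀ i → SumOfTwoUnits (Rs i) (φ y i)
        split i with i ≟ k
        ... | yes ≡.refl = L.∈M⇒sumOfTwoUnits i (E i) My
        ... | no i≢k     = L.q≢2⇒sumOfTwoUnits i (E i) (Q i) (λ qi≡2 → i≢k (at-most-one i k qi≡2 qk≡2)) (φ y i)

      -- Otherwise x = (x - 1) + 1 with (x - 1) in the previous case.
      one-two⇒∈S : ∀ x → S x
      one-two⇒∈S x with L.em k (M k (φ x k))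
      ... | inj₁ Mx = Mk⇒∈S Mx
      ... | inj₂ x∉M with φ-surjective (λ i → Rs._-_ i (φ x i) (Rs.1# i))
      ...   | y , φy≈x-1 = resp (R.sym x≈y+1) (+-closed (Mk⇒∈S My) has-1)
        where
        My : M k (φ y k)
        My = L.M.resp k (Rs.sym k (φy≈x-1 k)) (L.∉M⇒∼1 k (Q k) qk≡2 x∉M)
        x≈y+1 : x R.≈ y R.+ R.1#
        x≈y+1 = φ-injective λ i → Rs.trans i (Rs.sym i (AdditiveFacts.[y-r]+r≈y (Rs i) (φ x i) (Rs.1# i)))
                  (Rs.trans i (Rs.+-cong i (Rs.sym i (φy≈x-1 i)) (Rs.sym i (φ-1 i))) (Rs.sym i (φ-+ y R.1# i)))

  atMostOneTwo⇒generated : AtMostOneTwo → GeneratedByUnits R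
  atMostOneTwo⇒generated at-most-one S S-subring units⊆S with FinProperties.any? (λ k → q k ℕ.≟ 2)
  ... | yes (k , qk≡2) = one-two⇒∈S S S-subring units⊆S at-most-one k qk≡2
  ... | no no-two      = no-two⇒∈S S S-subring units⊆S (λ i qi≡2 → no-two (i , qi≡2))

  -- (⇒): two components with residue field 𝔽₂ give a proper subring.
  module _ {i j : Fin n} (j≢i : j ≢ i) (qi≡2 : q i ≡ 2) (qj≡2 : q j ≡ 2) where

    Balanced : Subset R
    Balanced x = M i (φ x i) ⇔ M j (φ x j)

    balanced-subring : IsSubring R Balanced
    balanced-subring = record
      { resp       = λ x≈y bx → ⇔.trans (⇔.sym (L.M-resp i (φ-cong x≈y i))) (⇔.trans bx (L.M-resp j (φ-cong x≈y j)))
      ; has-1      = mk⇔ (⊥-elim ∘ L.proper i ∘ L.M.resp i (φ-1 i)) (⊥-elim ∘ L.proper j ∘ L.M.resp j (φ-1 j))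
      ; +-closed   = λ {x} {y} bx by → ⇔.trans (plus i x y qi≡2) (⇔.trans (⇔-cong₂ bx by) (⇔.sym (plus j x y qj≡2)))
      ; neg-closed = λ {x} bx → ⇔.trans (neg i x) (⇔.trans bx (⇔.sym (neg j x)))
      ; *-closed   = λ {x} {y} bx by → ⇔.trans (times i x y) (⇔.trans (bx ⊎-⇔ by) (⇔.sym (times j x y)))
      }
      where
      plus : ∀ a x y → q a ≡ 2 → M a (φ (x R.+ y) a) ⇔ (M a (φ x a) ⇔ M a (φ y a))
      plus a x y qa≡2 = ⇔.trans (L.M-resp a (φ-+ x y a)) (L.+-parity a (Q a) qa≡2)
      times : ∀ a x y → M a (φ (x R.* y) a) ⇔ (M a (φ x a) ⊎ M a (φ y a))
      times a x y = ⇔.trans (L.M-resp a (φ-* x y a)) (L.*-parity a (E a))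
      neg : ∀ a x → M a (φ (R.- x) a) ⇔ M a (φ x a)
      neg a x = ⇔.trans (L.M-resp a (φ-neg x a)) (L.neg-parity a)

    -- Units have both components outside the maximal ideals.
    units-balanced : ∀ x → IsUnit R x → Balanced x
    units-balanced x x-unit = mk⇔ (⊥-elim ∘ L.unit∉M i (φ-unit x-unit i)) (⊥-elim ∘ L.unit∉M j (φ-unit x-unit j))

    unbalanced : ∃ λ z → ¬ Balanced z
    unbalanced with φ-surjective (Rs.1# [ i ≔ Rs.0# i ])
    ... | z , φz≈ = z , λ bz → L.proper j (L.M.resp j zj≈1 (to bz (L.M.resp i (Rs.sym i zi≈0) (L.M.has-0 i))))
      where
      zi≈0 : Rs._≈_ i (φ z i) (Rs.0# i)
      zi≈0 = Rs.trans i (φz≈ i) (Rs.reflexive i (update-at Rs.1# i (Rs.0# i)))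
      zj≈1 : Rs._≈_ j (φ z j) (Rs.1# j)
      zj≈1 = Rs.trans j (φz≈ j) (Rs.reflexive j (update-off Rs.1# i (Rs.0# i) j≢i))

  generated⇒atMostOneTwo : GeneratedByUnits R → AtMostOneTwo
  generated⇒atMostOneTwo generated i j qi≡2 qj≡2 with j ≟ i
  ... | yes j≡i = ≡.sym j≡i
  ... | no j≢i with unbalanced j≢i qi≡2 qj≡2
  ...   | z , z-unbalanced =
    ⊥-elim (z-unbalanced (generated (Balanced j≢i qi≡2 qj≡2) (balanced-subring j≢i qi≡2 qj≡2)
                                    (units-balanced j≢i qi≡2 qj≡2) z))

corollary1p3 : ∀ {c ℓ : Level} (R : CommutativeRing c ℓ) → Finite R →
    (n : ℕ) (Rs : Fin n → CommutativeRing c ℓ) → IsDirectSumOf R n Rs →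
    (M : (i : Fin n) → Subset (Rs i)) →
    (∀ i → IsUniqueMaximalIdeal (Rs i) (M i)) →
    (q : Fin n → ℕ) → (∀ i → QuotientHasSize (Rs i) (M i) (q i)) →
    GeneratedByUnits R ⇔ (∀ i j → q i ≡ 2 → q j ≡ 2 → i ≡ j)
corollary1p3 R R-finite n Rs D M U q Q =
  mk⇔ generated⇒atMostOneTwo atMostOneTwo⇒generated
  where open Classification R R-finite n Rs D M U q Q
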